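{- Let $D=(d_{ij})$ be the $2\times5$ matrix over $\mathbb{Z}[l,m,n,a,b,c,d,e]$ whose first row consists of the coefficients of $F_2$ and whose second row consists of the coefficients of $G_2$, each listed with respect to the monomials $x_1^4,x_1^3x_2,x_1^2x_2^2,x_1x_2^3,x_2^4$. Put $m_{ij}=d_{1i}d_{2j}-d_{1j}d_{2i}$. Then $\Delta=-27m_{15}^2+4m_{14}m_{25}-m_{13}m_{35}$.
   Context: For the generalised binary quartic $y^2+p(x_1,x_2)y=q(x_1,x_2)$ with $p=lx_1^2+mx_1x_2+nx_2^2$, $q=ax_1^4+bx_1^3x_2+cx_1^2x_2^2+dx_1x_2^3+ex_2^4$: $F_2=p^2+4q$ and $G_2=(-l^2c+lmb-m^2a-4ac+b^2)x_1^4+(-2l^2d+2lnb-4mna-8ad)x_1^3x_2+(-4l^2e-lmd+2lnc-mnb-4n^2a-16ae-2bd)x_1^2x_2^2+(-4lme+2lnd-2n^2b-8be)x_1x_2^3+(-m^2e+mnd-n^2c-4ce+d^2)x_2^4$. The discriminant $\Delta$: $a_1=m$, $a_2=-ln+c$, $a_3=ld+nb$, $a_4=-l^2e-lnc-n^2a-4ae+bd$, $a_6=-l^2ce+lmbe-lnbd-m^2ae+mnad-n^2ac-4ace+ad^2+b^2e$, $b_2=a_1^2+4a_2$, $b_4=2a_4+a_1a_3$, $b_6=a_3^2+4a_6$, $c_4=b_2^2-24b_4$, $c_6=-b_2^3+36b_2b_4-216b_6$, $\Delta=(c_4^3-c_6^2)/1728$. -}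

module Defs where

open import Data.Integer using (ℤ; +_; _+_; _-_; _*_; -_)
open import Data.Integer.DivMod using (_/_)
open import Data.Fin using (Fin; zero; suc)
open import Data.Vec using (Vec; []; _∷_; lookup)

-- All definitions below are polynomial expressions in the eight
-- indeterminates l m n a b c d e, evaluated at integer values.
module _ (l m n a b c d e : ℤ) where

  -- coefficients of F₂ = p² + 4q w.r.t. x₁⁴, x₁³x₂, x₁²x₂², x₁x₂³, x₂⁴
  -- (p² = l²x₁⁴ + 2lm x₁³x₂ + (m²+2ln) x₁²x₂² + 2mn x₁x₂³ + n² x₂⁴)
  F₂coeffs : Vec ℤ 5
  F₂coeffs =
      l * l + + 4 * a
    ∷ + 2 * l * m + + 4 * b
    ∷ m * m + + 2 * l * n + + 4 * c
    ∷ + 2 * m * n + + 4 * d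
    ∷ n * n + + 4 * e
    ∷ []

  G₂coeffs : Vec ℤ 5
  G₂coeffs =
      (- (l * l * c) + l * m * b - m * m * a - + 4 * a * c + b * b)
    ∷ (- (+ 2 * l * l * d) + + 2 * l * n * b - + 4 * m * n * a - + 8 * a * d)
    ∷ (- (+ 4 * l * l * e) - l * m * d + + 2 * l * n * c - m * n * b
         - + 4 * n * n * a - + 16 * a * e - + 2 * b * d)
    ∷ (- (+ 4 * l * m * e) + + 2 * l * n * d - + 2 * n * n * b - + 8 * b * e)
    ∷ (- (m * m * e) + m * n * d - n * n * c - + 4 * c * e + d * d)
    ∷ []

  -- the 2×5 matrix D; row 0 = F₂, row 1 = G₂; columns 0..4 correspond
  -- to the paper's indices 1..5
  D : Fin 2 → Fin 5 → ℤ
  D zero    j = lookup F₂coeffs j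
  D (suc _) j = lookup G₂coeffs j

  mm : Fin 5 → Fin 5 → ℤ
  mm i j = D zero i * D (suc zero) j - D zero j * D (suc zero) i

  a₁ a₂ a₃ a₄ a₆ : ℤ
  a₁ = m
  a₂ = - (l * n) + c
  a₃ = l * d + n * b
  a₄ = - (l * l * e) - l * n * c - n * n * a - + 4 * a * e + b * d
  a₆ = - (l * l * c * e) + l * m * b * e - l * n * b * d - m * m * a * e
       + m * n * a * d - n * n * a * c - + 4 * a * c * e + a * d * d + b * b * e

  b₂ b₄ b₆ c₄ c₆ : ℤ
  b₂ = a₁ * a₁ + + 4 * a₂
  b₄ = + 2 * a₄ + a₁ * a₃
  b₆ = a₃ * a₃ + + 4 * a₆
  c₄ = b₂ * b₂ - + 24 * b₄
  c₆ = - (b₂ * b₂ * b₂) + + 36 * b₂ * b₄ - + 216 * b₆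

  -- Δ = (c₄³ - c₆²)/1728 (the division is exact as polynomials)
  Δ : ℤ
  Δ = (c₄ * c₄ * c₄ - c₆ * c₆) / + 1728

-- Δ is defined through an integer division by 1728. As polynomials in l,m,n,a,b,c,d,e,
-- c₄³ − c₆² is exactly 1728 times the right-hand side (a ring-normalisation check), so
-- the division is exact and returns that right-hand side.
module Submission where

open import Defs
open import Data.Integer using (ℤ; +_; -[1+_]; _+_; _-_; _*_; -_; _/ℕ_; _/_)
open import Data.Integer.DivMod using (div-pos-is-/ℕ)
open import Data.Integer.Properties using (pos-*; neg-distribˡ-*)
open import Data.Integer.Tactic.RingSolver using (solve-∀)
import Data.Nat as ℕ
open import Data.Nat.DivMod using (m*n/n≡m; m*n%n≡0)
open import Data.Fin using (Fin; zero; suc)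
open import Relation.Binary.PropositionalEquality
  using (_≡_; refl; sym; cong; trans; module ≡-Reasoning)

-n/ℕd≡-[n/d] : ∀ n d .{{_ : ℕ.NonZero d}} → n ℕ.% d ≡ 0 → (- + n) /ℕ d ≡ - + (n ℕ./ d)
-n/ℕd≡-[n/d] ℕ.zero      d@(ℕ.suc _) _ = refl
-n/ℕd≡-[n/d] n@(ℕ.suc _) d           n%d≡0 with n ℕ.% d
... | ℕ.zero = refl
... | ℕ.suc _ with () ← n%d≡0

[i*d]/ℕd≡i : ∀ i d .{{_ : ℕ.NonZero d}} → (i * + d) /ℕ d ≡ i
[i*d]/ℕd≡i (+ n) d = begin
  + n * + d /ℕ d    ≡⟨ cong (_/ℕ d) (sym (pos-* n d)) ⟩
  + (n ℕ.* d) /ℕ d  ≡⟨ cong +_ (m*n/n≡m n d) ⟩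
  + n               ∎
  where open ≡-Reasoning
[i*d]/ℕd≡i i@(-[1+ n ]) d = begin
  i * + d /ℕ d                         ≡⟨ cong (_/ℕ d) (sym (neg-distribˡ-* (+ n′) (+ d))) ⟩
  - (+ n′ * + d) /ℕ d                  ≡⟨ cong (λ j → - j /ℕ d) (sym (pos-* n′ d)) ⟩
  - + (n′ ℕ.* d) /ℕ d                  ≡⟨ -n/ℕd≡-[n/d] (n′ ℕ.* d) d (m*n%n≡0 n′ d) ⟩
  - + (n′ ℕ.* d ℕ./ d)                 ≡⟨ cong (λ k → - + k) (m*n/n≡m n′ d) ⟩
  i                                    ∎
  where
  open ≡-Reasoning
  n′ : ℕ.ℕ
  n′ = ℕ.suc n

[i*d]/d≡i : ∀ i d .{{_ : ℕ.NonZero d}} → (i * + d) / + d ≡ i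
[i*d]/d≡i i d = trans (div-pos-is-/ℕ (i * + d) d) ([i*d]/ℕd≡i i d)

-- The let-block restates the definitions of Defs so that the reflective solver sees the
-- expanded polynomials; it cannot unfold named definitions itself.
c₄³-c₆²≡[-27m₁₅²+4m₁₄m₂₅-m₁₃m₃₅]*1728 : ∀ (l m n a b c d e : ℤ) →
  let f₁ = l * l + + 4 * a
      f₂ = + 2 * l * m + + 4 * b
      f₃ = m * m + + 2 * l * n + + 4 * c
      f₄ = + 2 * m * n + + 4 * d
      f₅ = n * n + + 4 * e
      g₁ = - (l * l * c) + l * m * b - m * m * a - + 4 * a * c + b * b
      g₂ = - (+ 2 * l * l * d) + + 2 * l * n * b - + 4 * m * n * a - + 8 * a * d
      g₃ = - (+ 4 * l * l * e) - l * m * d + + 2 * l * n * c - m * n * b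
           - + 4 * n * n * a - + 16 * a * e - + 2 * b * d
      g₄ = - (+ 4 * l * m * e) + + 2 * l * n * d - + 2 * n * n * b - + 8 * b * e
      g₅ = - (m * m * e) + m * n * d - n * n * c - + 4 * c * e + d * d
      m₁₃ = f₁ * g₃ - f₃ * g₁
      m₁₄ = f₁ * g₄ - f₄ * g₁
      m₁₅ = f₁ * g₅ - f₅ * g₁
      m₂₅ = f₂ * g₅ - f₅ * g₂
      m₃₅ = f₃ * g₅ - f₅ * g₃
      a₁ = m
      a₂ = - (l * n) + c
      a₃ = l * d + n * b
      a₄ = - (l * l * e) - l * n * c - n * n * a - + 4 * a * e + b * d
      a₆ = - (l * l * c * e) + l * m * b * e - l * n * b * d - m * m * a * e
           + m * n * a * d - n * n * a * c - + 4 * a * c * e + a * d * d + b * b * e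
      b₂ = a₁ * a₁ + + 4 * a₂
      b₄ = + 2 * a₄ + a₁ * a₃
      b₆ = a₃ * a₃ + + 4 * a₆
      c₄ = b₂ * b₂ - + 24 * b₄
      c₆ = - (b₂ * b₂ * b₂) + + 36 * b₂ * b₄ - + 216 * b₆
  in c₄ * c₄ * c₄ - c₆ * c₆
     ≡ (- (+ 27 * (m₁₅ * m₁₅)) + + 4 * (m₁₄ * m₂₅) - m₁₃ * m₃₅) * + 1728
c₄³-c₆²≡[-27m₁₅²+4m₁₄m₂₅-m₁₃m₃₅]*1728 = solve-∀

lemma4p11 : (l m n a b c d e : ℤ) →
    Δ l m n a b c d e ≡
      - (+ 27 * (mm l m n a b c d e zero (suc (suc (suc (suc zero))))
               * mm l m n a b c d e zero (suc (suc (suc (suc zero))))))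
      + + 4 * (mm l m n a b c d e zero (suc (suc (suc zero)))
               * mm l m n a b c d e (suc zero) (suc (suc (suc (suc zero)))))
      - mm l m n a b c d e zero (suc (suc zero))
        * mm l m n a b c d e (suc (suc zero)) (suc (suc (suc (suc zero))))
lemma4p11 l m n a b c d e =
  trans (cong (_/ + 1728) (c₄³-c₆²≡[-27m₁₅²+4m₁₄m₂₅-m₁₃m₃₅]*1728 l m n a b c d e))
        ([i*d]/d≡i _ 1728)
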